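{- For $n \in \{1,2,3,5\}$, the hypercube $Q_n$ has no $L_{16}$-decomposition.
   Context: For a positive integer $n$, the hypercube $Q_n$ is the graph whose vertices are the binary strings $x_1x_2\cdots x_n$ ($x_i\in\{0,1\}$), two vertices being adjacent if and only if they differ in exactly one position. The sunlet graph $L_{16}$ is the graph obtained from a cycle of length $8$ by attaching one pendant edge (to a new vertex) at each vertex of the cycle. For a graph $H$, an $H$-decomposition of a graph $G$ is a collection of edge-disjoint subgraphs of $G$, each isomorphic to $H$, whose edge sets partition $E(G)$. -}

module Defs where

open import Data.Nat using (ℕ)
open import Data.Bool using (Bool)
open import Data.Fin using (Fin; zero; suc)
open import Data.Vec using (Vec; lookup)
open import Data.Sum using (_⊎_)
open import Data.Product using (Σ; Σ-syntax; _×_)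
open import Relation.Binary.PropositionalEquality using (_≡_; _≢_)
open import Relation.Nullary using (¬_)

QVertex : ℕ → Set
QVertex n = Vec Bool n

QAdj : {n : ℕ} → QVertex n → QVertex n → Set
QAdj {n} u v =
  Σ[ i ∈ Fin n ] (lookup u i ≢ lookup v i
                 × ((j : Fin n) → j ≢ i → lookup u j ≡ lookup v j))

-- The sunlet graph L_16: an 8-cycle c_0 … c_7 with a pendant vertex p_i
-- attached to each c_i.  Vertices: inj₁ i = c_i, inj₂ i = p_i.

LVertex : Set
LVertex = Fin 8 ⊎ Fin 8

next8 : Fin 8 → Fin 8
next8 zero = suc zero
next8 (suc zero) = suc (suc zero)
next8 (suc (suc zero)) = suc (suc (suc zero))
next8 (suc (suc (suc zero))) = suc (suc (suc (suc zero)))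
next8 (suc (suc (suc (suc zero)))) = suc (suc (suc (suc (suc zero))))
next8 (suc (suc (suc (suc (suc zero))))) = suc (suc (suc (suc (suc (suc zero)))))
next8 (suc (suc (suc (suc (suc (suc zero)))))) = suc (suc (suc (suc (suc (suc (suc zero))))))
next8 (suc (suc (suc (suc (suc (suc (suc zero))))))) = zero

data LEdge : Set where
  cyc  : Fin 8 → LEdge
  pend : Fin 8 → LEdge

end₁ : LEdge → LVertex
end₁ (cyc i)  = Data.Sum.inj₁ i
end₁ (pend i) = Data.Sum.inj₁ i

end₂ : LEdge → LVertex
end₂ (cyc i)  = Data.Sum.inj₁ (next8 i)
end₂ (pend i) = Data.Sum.inj₂ i

-- A subgraph of Q_n isomorphic to L_16 = the image of an injective
-- graph homomorphism L_16 → Q_n (vertex set = image, edge set = images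
-- of the 16 edges).

record L16Copy (n : ℕ) : Set where
  field
    f     : LVertex → QVertex n
    inj   : (x y : LVertex) → f x ≡ f y → x ≡ y
    hom   : (e : LEdge) → QAdj (f (end₁ e)) (f (end₂ e))

ContainsEdge : {n : ℕ} → L16Copy n → QVertex n → QVertex n → Set
ContainsEdge c u v =
  Σ[ e ∈ LEdge ] ((L16Copy.f c (end₁ e) ≡ u × L16Copy.f c (end₂ e) ≡ v)
                 ⊎ (L16Copy.f c (end₁ e) ≡ v × L16Copy.f c (end₂ e) ≡ u))

-- An L_16-decomposition of Q_n: finitely many copies of L_16 in Q_n such
-- that every edge of Q_n lies in exactly one copy (edge-disjointness +
-- covering all edges).

L16Decomposition : ℕ → Set
L16Decomposition n =
  Σ[ k ∈ ℕ ] Σ[ copies ∈ (Fin k → L16Copy n) ]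
    ((u v : QVertex n) → QAdj u v →
       Σ[ j ∈ Fin k ] (ContainsEdge (copies j) u v
                      × ((j′ : Fin k) → ContainsEdge (copies j′) u v → j′ ≡ j)))

-- A copy of L₁₆ has 16 distinct vertices, so none fits into Q_n for n ≤ 3.
-- In Q₅, give each end u of an edge its role in the unique copy containing the
-- edge.  If u is a root (the cycle end of a pendant edge) in direction s, then u
-- is a cycle vertex of that copy and uses three of its five edges there; a second
-- root would need three more, so s is the only root, the two cycle edges at u are
-- the only rim ends, and the remaining two ends are leaves.  A vertex that is never
-- a root has no rim ends either, hence five leaf ends.  So every vertex has more
-- leaf ends than root ends, while every pendant edge has exactly one of each.

module Submission where

open import Defs
open import Algebra.Properties.CommutativeSemigroup as CommSemigroup using ()
open import Data.Bool using (Bool; true; false; not; if_then_else_; _∨_)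
open import Data.Bool.Properties using (not-involutive; not-¬; ¬-not)
open import Data.Empty using (⊥-elim)
open import Data.Fin using (Fin; zero; suc; _≟_; splitAt; join; combine)
open import Data.Fin.Patterns using (0F; 1F; 2F; 3F; 4F; 5F; 6F; 7F)
open import Data.Fin.Properties
  using (join-splitAt; combine-injectiveˡ; combine-injectiveʳ; injective⇒≤; any?; all?)
open import Data.Nat using (ℕ; zero; suc; _+_; _≤_; _<_; _^_; z≤n; s≤s; _≤?_)
open import Data.Nat.Properties
  using (≤-refl; ≤-<-trans; <⇒≱; <ᵇ⇒<; +-mono-≤; +-mono-<-≤; <⇒≤; ^-monoʳ-≤;
         +-comm; +-0-commutativeMonoid; +-commutativeSemigroup; module ≤-Reasoning)
open import Data.Product using (Σ-syntax; _×_; _,_; proj₁; proj₂)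
open import Data.Sum using (_⊎_; inj₁; inj₂; [_,_])
import Data.Sum as Sum
open import Data.Sum.Properties using (inj₁-injective)
open import Data.Vec using ([]; _∷_; lookup; tabulate; replicate; _[_]%=_)
open import Data.Vec.Properties
  using (lookup∘updateAt; lookup∘updateAt′; updateAt-updateAt; updateAt-cong; updateAt-id;
         tabulate∘lookup; tabulate-cong)
open import Function using (_∘_; id)
open import Function.Definitions using (Injective)
open import Relation.Binary.PropositionalEquality
  using (_≡_; _≢_; _≗_; refl; sym; trans; cong; cong₂; subst; subst₂; module ≡-Reasoning)
open import Relation.Nullary using (¬_; Dec; yes; no; does; ¬?)
open import Relation.Nullary.Decidable using (toWitness)
open import Algebra.Properties.CommutativeMonoid.Sum +-0-commutativeMonoid
  using (sum; sum-syntax; sum-cong-≗)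

flipAt : ∀ {n} → QVertex n → Fin n → QVertex n
flipAt u i = u [ i ]%= not

flipAt-adjacent : ∀ {n} (u : QVertex n) (i : Fin n) → QAdj u (flipAt u i)
flipAt-adjacent u i =
  i , (λ e → not-¬ refl (trans e (lookup∘updateAt i u)))
    , (λ j j≢i → sym (lookup∘updateAt′ j i j≢i u))

QAdj⇒≡flipAt : ∀ {n} {u v : QVertex n} (a : QAdj u v) → v ≡ flipAt u (proj₁ a)
QAdj⇒≡flipAt {u = u} {v} (i , differ , agree) = begin
  v                              ≡⟨ tabulate∘lookup v ⟨
  tabulate (lookup v)            ≡⟨ tabulate-cong coordinate ⟩
  tabulate (lookup (flipAt u i)) ≡⟨ tabulate∘lookup (flipAt u i) ⟩
  flipAt u i                     ∎
  where
  open ≡-Reasoning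
  coordinate : ∀ j → lookup v j ≡ lookup (flipAt u i) j
  coordinate j with j ≟ i
  ... | yes refl = trans (¬-not (differ ∘ sym)) (sym (lookup∘updateAt i u))
  ... | no j≢i   = trans (sym (agree j j≢i)) (sym (lookup∘updateAt′ j i j≢i u))

flipAt-involutive : ∀ {n} (u : QVertex n) (i : Fin n) → flipAt (flipAt u i) i ≡ u
flipAt-involutive u i = begin
  flipAt (flipAt u i) i ≡⟨ updateAt-updateAt i u ⟩
  u [ i ]%= (not ∘ not) ≡⟨ updateAt-cong i not-involutive u ⟩
  u [ i ]%= id          ≡⟨ updateAt-id i u ⟩
  u                     ∎
  where open ≡-Reasoning

flipAt-sym : ∀ {n} {u v : QVertex n} {i : Fin n} → v ≡ flipAt u i → u ≡ flipAt v i
flipAt-sym {u = u} {i = i} refl = sym (flipAt-involutive u i)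

flipAt-injective : ∀ {n} {u : QVertex n} {i j : Fin n} → flipAt u i ≡ flipAt u j → i ≡ j
flipAt-injective {u = u} {i} {j} e with i ≟ j
... | yes i≡j = i≡j
... | no i≢j  = ⊥-elim (not-¬ refl (begin
  lookup u i              ≡⟨ lookup∘updateAt′ i j i≢j u ⟨
  lookup (flipAt u j) i   ≡⟨ cong (λ w → lookup w i) e ⟨
  lookup (flipAt u i) i   ≡⟨ lookup∘updateAt i u ⟩
  not (lookup u i)        ∎))
  where open ≡-Reasoning

splitAt-injective : ∀ m {n} → Injective _≡_ _≡_ (splitAt m {n})
splitAt-injective m {n} {i} {j} e = begin
  i                      ≡⟨ join-splitAt m n i ⟨
  join m n (splitAt m i) ≡⟨ cong (join m n) e ⟩
  join m n (splitAt m j) ≡⟨ join-splitAt m n j ⟩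
  j                      ∎
  where open ≡-Reasoning

bit : Bool → Fin 2
bit false = 0F
bit true  = 1F

bit-injective : Injective _≡_ _≡_ bit
bit-injective {false} {false} _ = refl
bit-injective {true}  {true}  _ = refl

toFin : ∀ {n} → QVertex n → Fin (2 ^ n)
toFin []      = zero
toFin (b ∷ u) = combine (bit b) (toFin u)

toFin-injective : ∀ {n} → Injective _≡_ _≡_ (toFin {n})
toFin-injective {x = []}    {[]}    _ = refl
toFin-injective {x = b ∷ u} {c ∷ v} e =
  cong₂ _∷_ (bit-injective (combine-injectiveˡ (bit b) (toFin u) (bit c) (toFin v) e))
            (toFin-injective (combine-injectiveʳ (bit b) (toFin u) (bit c) (toFin v) e))

copy⇒16≤2^n : ∀ {n} → L16Copy n → 16 ≤ 2 ^ n
copy⇒16≤2^n c = injective⇒≤ (splitAt-injective 8 ∘ inj _ _ ∘ toFin-injective)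
  where open L16Copy c

copyOf : ∀ {n} → L16Decomposition (suc n) → L16Copy (suc n)
copyOf {n} (_ , copies , cover) =
  copies (proj₁ (cover u (flipAt u zero) (flipAt-adjacent u zero)))
  where
  u : QVertex (suc n)
  u = replicate (suc n) false

no-L16-decomposition-below-Q4 : ∀ n → n < 3 → ¬ L16Decomposition (suc n)
no-L16-decomposition-below-Q4 n n<3 d =
  <⇒≱ (≤-<-trans (^-monoʳ-≤ 2 n<3) (<ᵇ⇒< 8 16 _)) (copy⇒16≤2^n (copyOf d))

∑ᵥ : ∀ {n} → (QVertex n → ℕ) → ℕ
∑ᵥ {zero}  g = g []
∑ᵥ {suc n} g = ∑ᵥ (λ u → g (false ∷ u)) + ∑ᵥ (λ u → g (true ∷ u))

∑ᵥ-mono-≤ : ∀ {n} {g h : QVertex n → ℕ} → (∀ u → g u ≤ h u) → ∑ᵥ g ≤ ∑ᵥ h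
∑ᵥ-mono-≤ {zero}  g≤h = g≤h []
∑ᵥ-mono-≤ {suc n} g≤h =
  +-mono-≤ (∑ᵥ-mono-≤ (g≤h ∘ (false ∷_))) (∑ᵥ-mono-≤ (g≤h ∘ (true ∷_)))

∑ᵥ-mono-< : ∀ {n} {g h : QVertex n → ℕ} → (∀ u → g u < h u) → ∑ᵥ g < ∑ᵥ h
∑ᵥ-mono-< {zero}  g<h = g<h []
∑ᵥ-mono-< {suc n} g<h =
  +-mono-<-≤ (∑ᵥ-mono-< (g<h ∘ (false ∷_))) (∑ᵥ-mono-≤ (<⇒≤ ∘ g<h ∘ (true ∷_)))

∑ᵥ-zero : ∀ n → ∑ᵥ {n} (λ _ → 0) ≡ 0
∑ᵥ-zero zero    = refl
∑ᵥ-zero (suc n) = cong₂ _+_ (∑ᵥ-zero n) (∑ᵥ-zero n)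

∑ᵥ-distrib-+ : ∀ {n} (g h : QVertex n → ℕ) → ∑ᵥ (λ u → g u + h u) ≡ ∑ᵥ g + ∑ᵥ h
∑ᵥ-distrib-+ {zero}  g h = refl
∑ᵥ-distrib-+ {suc n} g h = begin
  ∑ᵥ (λ u → g (false ∷ u) + h (false ∷ u)) + ∑ᵥ (λ u → g (true ∷ u) + h (true ∷ u))
    ≡⟨ cong₂ _+_ (∑ᵥ-distrib-+ (g ∘ (false ∷_)) (h ∘ (false ∷_)))
                 (∑ᵥ-distrib-+ (g ∘ (true ∷_)) (h ∘ (true ∷_))) ⟩
  (∑ᵥ (g ∘ (false ∷_)) + ∑ᵥ (h ∘ (false ∷_))) + (∑ᵥ (g ∘ (true ∷_)) + ∑ᵥ (h ∘ (true ∷_)))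
    ≡⟨ CommSemigroup.interchange +-commutativeSemigroup
         (∑ᵥ (g ∘ (false ∷_))) (∑ᵥ (h ∘ (false ∷_))) (∑ᵥ (g ∘ (true ∷_))) (∑ᵥ (h ∘ (true ∷_))) ⟩
  ∑ᵥ g + ∑ᵥ h ∎
  where open ≡-Reasoning

∑ᵥ-comm : ∀ {n} m (g : QVertex n → Fin m → ℕ) →
          ∑ᵥ (λ u → ∑[ i < m ] g u i) ≡ ∑[ i < m ] ∑ᵥ (λ u → g u i)
∑ᵥ-comm {n} zero    g = ∑ᵥ-zero n
∑ᵥ-comm     (suc m) g =
  trans (∑ᵥ-distrib-+ (λ u → g u zero) (λ u → ∑[ i < m ] g u (suc i)))
        (cong (∑ᵥ (λ u → g u zero) +_) (∑ᵥ-comm m (λ u → g u ∘ suc)))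

∑ᵥ-flipAt : ∀ {n} (i : Fin n) (g : QVertex n → ℕ) → ∑ᵥ (λ u → g (flipAt u i)) ≡ ∑ᵥ g
∑ᵥ-flipAt zero    g = +-comm (∑ᵥ (g ∘ (true ∷_))) (∑ᵥ (g ∘ (false ∷_)))
∑ᵥ-flipAt (suc i) g =
  cong₂ _+_ (∑ᵥ-flipAt i (g ∘ (false ∷_))) (∑ᵥ-flipAt i (g ∘ (true ∷_)))

∑ᵥ-∑-flipAt : ∀ {n} (g : QVertex n → Fin n → ℕ) →
              ∑ᵥ (λ u → ∑[ i < n ] g (flipAt u i) i) ≡ ∑ᵥ (λ u → ∑[ i < n ] g u i)
∑ᵥ-∑-flipAt {n} g = begin
  ∑ᵥ (λ u → ∑[ i < n ] g (flipAt u i) i) ≡⟨ ∑ᵥ-comm n (λ u i → g (flipAt u i) i) ⟩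
  ∑[ i < n ] ∑ᵥ (λ u → g (flipAt u i) i) ≡⟨ sum-cong-≗ (λ i → ∑ᵥ-flipAt i (λ u → g u i)) ⟩
  ∑[ i < n ] ∑ᵥ (λ u → g u i)            ≡⟨ ∑ᵥ-comm n g ⟨
  ∑ᵥ (λ u → ∑[ i < n ] g u i)            ∎
  where open ≡-Reasoning

sum-mono-≤ : ∀ {m} {g h : Fin m → ℕ} → (∀ i → g i ≤ h i) → sum g ≤ sum h
sum-mono-≤ {zero}  g≤h = z≤n
sum-mono-≤ {suc m} g≤h = +-mono-≤ (g≤h zero) (sum-mono-≤ (g≤h ∘ suc))

-- The role of an end u of an edge uv within a copy: root if uv is the pendant
-- edge c_m p_m with u = c_m, leaf if it is that edge with u = p_m, rim if uv is a
-- cycle edge.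
data Role : Set where
  root rim leaf : Role

isRoot : Role → ℕ
isRoot root = 1
isRoot _    = 0

isLeaf : Role → ℕ
isLeaf leaf = 1
isLeaf _    = 0

root≢leaf : root ≢ leaf
root≢leaf ()

rim≢leaf : rim ≢ leaf
rim≢leaf ()

root? : (ρ : Role) → Dec (ρ ≡ root)
root? root = yes refl
root? rim  = no λ ()
root? leaf = no λ ()

-- The d edges at a single vertex, with their roles and the copies owning them.
module Star {d : ℕ} {K : Set} (role : Fin d → Role) (owner : Fin d → K) where

  record Hub (j : K) : Set where
    field
      stem left right : Fin d
      stem-root   : role stem ≡ root
      left-rim    : role left ≡ rim
      right-rim   : role right ≡ rim
      owner-stem  : owner stem ≡ j
      owner-left  : owner left ≡ j
      owner-right : owner right ≡ j
      left≢right  : left ≢ right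
      root-stem   : ∀ z → role z ≡ root → owner z ≡ j → z ≡ stem
      rim-sides   : ∀ z → role z ≡ rim → owner z ≡ j → z ≡ left ⊎ z ≡ right

    spoke : Fin 3 → Fin d
    spoke 0F = stem
    spoke 1F = left
    spoke 2F = right

    owner-spoke : ∀ s → owner (spoke s) ≡ j
    owner-spoke 0F = owner-stem
    owner-spoke 1F = owner-left
    owner-spoke 2F = owner-right

    stem≢rim : ∀ {z} → role z ≡ rim → stem ≢ z
    stem≢rim ρ e with trans (sym stem-root) (trans (cong role e) ρ)
    ... | ()

    spoke-injective : Injective _≡_ _≡_ spoke
    spoke-injective {0F} {0F} _ = refl
    spoke-injective {1F} {1F} _ = refl
    spoke-injective {2F} {2F} _ = refl
    spoke-injective {0F} {1F} e = ⊥-elim (stem≢rim left-rim e)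
    spoke-injective {0F} {2F} e = ⊥-elim (stem≢rim right-rim e)
    spoke-injective {1F} {0F} e = ⊥-elim (stem≢rim left-rim (sym e))
    spoke-injective {2F} {0F} e = ⊥-elim (stem≢rim right-rim (sym e))
    spoke-injective {1F} {2F} e = ⊥-elim (left≢right e)
    spoke-injective {2F} {1F} e = ⊥-elim (left≢right (sym e))

  open Hub

  Hubs : Set
  Hubs = ∀ i → role i ≢ leaf → Hub (owner i)

  two-roots⇒6≤d : Hubs → ∀ {i i′} → role i ≡ root → role i′ ≡ root → i ≢ i′ → 6 ≤ d
  two-roots⇒6≤d hubs {i} {i′} ρ ρ′ i≢i′ =
    injective⇒≤ {f = [spokes] ∘ splitAt 3} (splitAt-injective 3 ∘ [spokes]-injective)
    where
    h : Hub (owner i)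
    h = hubs i (root≢leaf ∘ trans (sym ρ))
    h′ : Hub (owner i′)
    h′ = hubs i′ (root≢leaf ∘ trans (sym ρ′))
    owner≢ : owner i ≢ owner i′
    owner≢ e = i≢i′ (trans (root-stem h i ρ refl) (sym (root-stem h i′ ρ′ (sym e))))
    spokes-differ : ∀ s t → spoke h s ≢ spoke h′ t
    spokes-differ s t e =
      owner≢ (trans (sym (owner-spoke h s)) (trans (cong owner e) (owner-spoke h′ t)))
    [spokes] : Fin 3 ⊎ Fin 3 → Fin d
    [spokes] = [ spoke h , spoke h′ ]
    [spokes]-injective : Injective _≡_ _≡_ [spokes]
    [spokes]-injective {inj₁ s} {inj₁ t} e = cong inj₁ (spoke-injective h e)
    [spokes]-injective {inj₂ s} {inj₂ t} e = cong inj₂ (spoke-injective h′ e)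
    [spokes]-injective {inj₁ s} {inj₂ t} e = ⊥-elim (spokes-differ s t e)
    [spokes]-injective {inj₂ s} {inj₁ t} e = ⊥-elim (spokes-differ t s (sym e))

hubProfile : Fin 5 → Fin 5 → Fin 5 → Fin 5 → Role
hubProfile s x y z =
  if does (z ≟ s) then root else if does (z ≟ x) ∨ does (z ≟ y) then rim else leaf

hubProfile-leaves>roots : ∀ s x y →
  ∑[ z < 5 ] isRoot (hubProfile s x y z) < ∑[ z < 5 ] isLeaf (hubProfile s x y z)
hubProfile-leaves>roots = toWitness {a? = all? λ s → all? λ x → all? λ y →
  suc (∑[ z < 5 ] isRoot (hubProfile s x y z)) ≤? ∑[ z < 5 ] isLeaf (hubProfile s x y z)} _

module _ {K : Set} (role : Fin 5 → Role) (owner : Fin 5 → K) (hubs : Star.Hubs role owner) where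
  open Star role owner
  open Hub

  leaves>roots-from : (profile : Fin 5 → Role) → role ≗ profile →
    ∑[ z < 5 ] isRoot (profile z) < ∑[ z < 5 ] isLeaf (profile z) →
    ∑[ z < 5 ] isRoot (role z) < ∑[ z < 5 ] isLeaf (role z)
  leaves>roots-from profile eq =
    subst₂ _<_ (sym (sum-cong-≗ (cong isRoot ∘ eq))) (sym (sum-cong-≗ (cong isLeaf ∘ eq)))

  no-root⇒leaf : (∀ z → role z ≢ root) → ∀ z → role z ≡ leaf
  no-root⇒leaf ∄root z with role z in e
  ... | root = ⊥-elim (∄root z e)
  ... | rim  = ⊥-elim (∄root _ (stem-root (hubs z (rim≢leaf ∘ trans (sym e)))))
  ... | leaf = refl

  module _ {s : Fin 5} (ρ : role s ≡ root) where

    hub-s : Hub (owner s)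
    hub-s = hubs s (root≢leaf ∘ trans (sym ρ))

    root-is-s : ∀ {z} → role z ≡ root → z ≡ s
    root-is-s {z} ρz with z ≟ s
    ... | yes z≡s = z≡s
    ... | no z≢s  = ⊥-elim (<⇒≱ (<ᵇ⇒< 5 6 _) (two-roots⇒6≤d hubs ρz ρ z≢s))

    rim-owned-by-s : ∀ {z} → role z ≡ rim → owner z ≡ owner s
    rim-owned-by-s {z} e = trans (sym (owner-stem h)) (cong owner (root-is-s (stem-root h)))
      where
      h : Hub (owner z)
      h = hubs z (rim≢leaf ∘ trans (sym e))

    off-hub⇒leaf : ∀ z → z ≢ s → z ≢ left hub-s → z ≢ right hub-s → role z ≡ leaf
    off-hub⇒leaf z z≢s z≢l z≢r with role z in e
    ... | root = ⊥-elim (z≢s (root-is-s e))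
    ... | rim  = ⊥-elim ([ z≢l , z≢r ] (rim-sides hub-s z e (rim-owned-by-s e)))
    ... | leaf = refl

    role≗hubProfile : role ≗ hubProfile s (left hub-s) (right hub-s)
    role≗hubProfile z with z ≟ s | z ≟ left hub-s | z ≟ right hub-s
    ... | yes refl | _        | _        = ρ
    ... | no _     | yes refl | _        = left-rim hub-s
    ... | no _     | no _     | yes refl = right-rim hub-s
    ... | no z≢s   | no z≢l   | no z≢r   = off-hub⇒leaf z z≢s z≢l z≢r

  leaves>roots : ∑[ z < 5 ] isRoot (role z) < ∑[ z < 5 ] isLeaf (role z)
  leaves>roots with any? (λ i → root? (role i))
  ... | no ∄root =
    leaves>roots-from (λ _ → leaf) (no-root⇒leaf (λ z e → ∄root (z , e))) (s≤s z≤n)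
  ... | yes (s , ρ) =
    leaves>roots-from _ (role≗hubProfile ρ)
      (hubProfile-leaves>roots s (left (hub-s ρ)) (right (hub-s ρ)))

prev8 : Fin 8 → Fin 8
prev8 0F = 7F
prev8 1F = 0F
prev8 2F = 1F
prev8 3F = 2F
prev8 4F = 3F
prev8 5F = 4F
prev8 6F = 5F
prev8 7F = 6F

next8∘prev8 : ∀ m → next8 (prev8 m) ≡ m
next8∘prev8 = toWitness {a? = all? λ m → next8 (prev8 m) ≟ m} _

prev8∘next8 : ∀ m → prev8 (next8 m) ≡ m
prev8∘next8 = toWitness {a? = all? λ m → prev8 (next8 m) ≟ m} _

next8≢prev8 : ∀ m → next8 m ≢ prev8 m
next8≢prev8 = toWitness {a? = all? λ m → ¬? (next8 m ≟ prev8 m)} _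

module SunletCopy {n} (c : L16Copy n) where
  open L16Copy c

  dir : LEdge → Fin n
  dir e = proj₁ (hom e)

  end₂≡flipAt : ∀ e → f (end₂ e) ≡ flipAt (f (end₁ e)) (dir e)
  end₂≡flipAt e = QAdj⇒≡flipAt (hom e)

  prev8-neighbour : ∀ m → f (inj₁ (prev8 m)) ≡ flipAt (f (inj₁ m)) (dir (cyc (prev8 m)))
  prev8-neighbour m =
    subst (λ x → f (inj₁ (prev8 m)) ≡ flipAt (f (inj₁ x)) (dir (cyc (prev8 m))))
          (next8∘prev8 m) (flipAt-sym (end₂≡flipAt (cyc (prev8 m))))

  cycle-injective : ∀ {m m′} → f (inj₁ m) ≡ f (inj₁ m′) → m ≡ m′
  cycle-injective = inj₁-injective ∘ inj _ _

  cycle-leaf-clash : ∀ {A : Set} {m m′ x} → f (inj₁ m) ≡ x → f (inj₂ m′) ≡ x → A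
  cycle-leaf-clash a b with inj _ _ (trans a (sym b))
  ... | ()

  roleOf : ∀ {u v} → ContainsEdge c u v → Role
  roleOf (cyc _  , _)      = rim
  roleOf (pend _ , inj₁ _) = root
  roleOf (pend _ , inj₂ _) = leaf

  roleOf-unique : ∀ {u v} (w w′ : ContainsEdge c u v) → roleOf w ≡ roleOf w′
  roleOf-unique (cyc _  , _)      (cyc _  , _)                  = refl
  roleOf-unique (pend _ , inj₁ _) (pend _ , inj₁ _)             = refl
  roleOf-unique (pend _ , inj₂ _) (pend _ , inj₂ _)             = refl
  roleOf-unique (pend _ , inj₁ (a , _)) (pend _ , inj₂ (_ , b)) = cycle-leaf-clash a b
  roleOf-unique (pend _ , inj₂ (_ , b)) (pend _ , inj₁ (a , _)) = cycle-leaf-clash a b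
  roleOf-unique (cyc _  , inj₁ (_ , a)) (pend _ , inj₁ (_ , b)) = cycle-leaf-clash a b
  roleOf-unique (cyc _  , inj₁ (a , _)) (pend _ , inj₂ (_ , b)) = cycle-leaf-clash a b
  roleOf-unique (cyc _  , inj₂ (a , _)) (pend _ , inj₁ (_ , b)) = cycle-leaf-clash a b
  roleOf-unique (cyc _  , inj₂ (_ , a)) (pend _ , inj₂ (_ , b)) = cycle-leaf-clash a b
  roleOf-unique (pend _ , inj₁ (_ , b)) (cyc _  , inj₁ (_ , a)) = cycle-leaf-clash a b
  roleOf-unique (pend _ , inj₂ (_ , b)) (cyc _  , inj₁ (a , _)) = cycle-leaf-clash a b
  roleOf-unique (pend _ , inj₁ (_ , b)) (cyc _  , inj₂ (a , _)) = cycle-leaf-clash a b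
  roleOf-unique (pend _ , inj₂ (_ , b)) (cyc _  , inj₂ (_ , a)) = cycle-leaf-clash a b

  on-cycle : ∀ {u v} (w : ContainsEdge c u v) → roleOf w ≢ leaf → Σ[ m ∈ Fin 8 ] f (inj₁ m) ≡ u
  on-cycle (cyc m  , inj₁ (a , _)) _     = m , a
  on-cycle (cyc m  , inj₂ (_ , b)) _     = next8 m , b
  on-cycle (pend m , inj₁ (a , _)) _     = m , a
  on-cycle (pend m , inj₂ _)       ¬leaf = ⊥-elim (¬leaf refl)

  root-target : ∀ {m u v} → f (inj₁ m) ≡ u → (w : ContainsEdge c u v) → roleOf w ≡ root →
                v ≡ f (inj₂ m)
  root-target a (pend m′ , inj₁ (a′ , b′)) _ with cycle-injective (trans a (sym a′))
  ... | refl = sym b′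

  rim-target : ∀ {m u v} → f (inj₁ m) ≡ u → (w : ContainsEdge c u v) → roleOf w ≡ rim →
               v ≡ f (inj₁ (next8 m)) ⊎ v ≡ f (inj₁ (prev8 m))
  rim-target a (cyc m′ , inj₁ (a′ , b′)) _ with cycle-injective (trans a (sym a′))
  ... | refl = inj₁ (sym b′)
  rim-target a (cyc m′ , inj₂ (a′ , b′)) _ with cycle-injective (trans a (sym b′))
  ... | refl = inj₂ (trans (sym a′) (cong (f ∘ inj₁) (sym (prev8∘next8 m′))))

module Roles {n} (d : L16Decomposition n) where
  open SunletCopy

  k : ℕ
  k = proj₁ d

  copies : Fin k → L16Copy n
  copies = proj₁ (proj₂ d)

  vertex : Fin k → LVertex → QVertex n
  vertex j = L16Copy.f (copies j)

  cover : ∀ u i → Σ[ j ∈ Fin k ] (ContainsEdge (copies j) u (flipAt u i)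
                   × (∀ j′ → ContainsEdge (copies j′) u (flipAt u i) → j′ ≡ j))
  cover u i = proj₂ (proj₂ d) u (flipAt u i) (flipAt-adjacent u i)

  owner : QVertex n → Fin n → Fin k
  owner u i = proj₁ (cover u i)

  owner-contains : ∀ u i → ContainsEdge (copies (owner u i)) u (flipAt u i)
  owner-contains u i = proj₁ (proj₂ (cover u i))

  owner-unique : ∀ {j u i} → ContainsEdge (copies j) u (flipAt u i) → j ≡ owner u i
  owner-unique {j} {u} {i} = proj₂ (proj₂ (cover u i)) j

  role : QVertex n → Fin n → Role
  role u i = roleOf (copies (owner u i)) (owner-contains u i)

  role-at : ∀ {j u v} i → v ≡ flipAt u i → (w : ContainsEdge (copies j) u v) →
            owner u i ≡ j × role u i ≡ roleOf (copies j) w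
  role-at {j} {u} i refl w with owner-unique w
  ... | refl = refl , roleOf-unique (copies j) (owner-contains u i) w

  contains-at : ∀ {j u i} → owner u i ≡ j →
                Σ[ w ∈ ContainsEdge (copies j) u (flipAt u i) ] role u i ≡ roleOf (copies j) w
  contains-at {u = u} {i} refl = owner-contains u i , refl

  hub : ∀ {j m u} → vertex j (inj₁ m) ≡ u → Star.Hub (role u) (owner u) j
  hub {j} {m} refl = record
    { stem        = dir c (pend m)
    ; left        = dir c (cyc m)
    ; right       = dir c (cyc (prev8 m))
    ; stem-root   = proj₂ stem-edge
    ; left-rim    = proj₂ left-edge
    ; right-rim   = proj₂ right-edge
    ; owner-stem  = proj₁ stem-edge
    ; owner-left  = proj₁ left-edge
    ; owner-right = proj₁ right-edge
    ; left≢right  = λ e → next8≢prev8 m (cycle-injective c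
        (trans (end₂≡flipAt c (cyc m)) (trans (cong (flipAt u) e) (sym (prev8-neighbour c m)))))
    ; root-stem   = λ z ρ o → let (w , ρw) = contains-at o in
        flipAt-injective
          (trans (root-target c refl w (trans (sym ρw) ρ)) (end₂≡flipAt c (pend m)))
    ; rim-sides   = λ z ρ o → let (w , ρw) = contains-at o in
        Sum.map (λ e → flipAt-injective (trans e (end₂≡flipAt c (cyc m))))
                (λ e → flipAt-injective (trans e (prev8-neighbour c m)))
                (rim-target c refl w (trans (sym ρw) ρ))
    }
    where
    c : L16Copy n
    c = copies j
    u : QVertex n
    u = vertex j (inj₁ m)
    stem-edge : owner u (dir c (pend m)) ≡ j × role u (dir c (pend m)) ≡ root
    stem-edge = role-at (dir c (pend m)) (end₂≡flipAt c (pend m)) (pend m , inj₁ (refl , refl))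
    left-edge : owner u (dir c (cyc m)) ≡ j × role u (dir c (cyc m)) ≡ rim
    left-edge = role-at (dir c (cyc m)) (end₂≡flipAt c (cyc m)) (cyc m , inj₁ (refl , refl))
    right-edge : owner u (dir c (cyc (prev8 m))) ≡ j × role u (dir c (cyc (prev8 m))) ≡ rim
    right-edge = role-at (dir c (cyc (prev8 m))) (prev8-neighbour c m)
                   (cyc (prev8 m) , inj₂ (refl , cong (vertex j ∘ inj₁) (next8∘prev8 m)))

  hubs : ∀ u → Star.Hubs (role u) (owner u)
  hubs u i ¬leaf = hub (proj₂ (on-cycle (copies (owner u i)) (owner-contains u i) ¬leaf))

  leaf⇒root : ∀ u i → role u i ≡ leaf → role (flipAt u i) i ≡ root
  leaf⇒root u i = leaf-end (owner-contains u i)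
    where
    leaf-end : ∀ {j} (w : ContainsEdge (copies j) u (flipAt u i)) → roleOf (copies j) w ≡ leaf →
               role (flipAt u i) i ≡ root
    leaf-end (pend m , inj₂ (a , b)) _ =
      proj₂ (role-at i (trans b (sym (flipAt-involutive u i))) (pend m , inj₁ (a , refl)))

  leaf≤root : ∀ u i → isLeaf (role u i) ≤ isRoot (role (flipAt u i) i)
  leaf≤root u i with role u i in e
  ... | root = z≤n
  ... | rim  = z≤n
  ... | leaf rewrite leaf⇒root u i e = ≤-refl

  leaves≤roots : ∑ᵥ (λ u → ∑[ i < n ] isLeaf (role u i))
               ≤ ∑ᵥ (λ u → ∑[ i < n ] isRoot (role u i))
  leaves≤roots = begin
    ∑ᵥ (λ u → ∑[ i < n ] isLeaf (role u i))
      ≤⟨ ∑ᵥ-mono-≤ (λ u → sum-mono-≤ (leaf≤root u)) ⟩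
    ∑ᵥ (λ u → ∑[ i < n ] isRoot (role (flipAt u i) i))
      ≡⟨ ∑ᵥ-∑-flipAt (λ u i → isRoot (role u i)) ⟩
    ∑ᵥ (λ u → ∑[ i < n ] isRoot (role u i))
      ∎
    where open ≤-Reasoning

no-L16-decomposition-Q5 : ¬ L16Decomposition 5
no-L16-decomposition-Q5 d =
  <⇒≱ (∑ᵥ-mono-< (λ u → leaves>roots (role u) (owner u) (hubs u))) leaves≤roots
  where open Roles d

lemma3 : (n : ℕ) → (n ≡ 1 ⊎ n ≡ 2 ⊎ n ≡ 3 ⊎ n ≡ 5) → ¬ L16Decomposition n
lemma3 _ (inj₁ refl)                = no-L16-decomposition-below-Q4 0 (s≤s z≤n)
lemma3 _ (inj₂ (inj₁ refl))         = no-L16-decomposition-below-Q4 1 (s≤s (s≤s z≤n))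
lemma3 _ (inj₂ (inj₂ (inj₁ refl)))  = no-L16-decomposition-below-Q4 2 ≤-refl
lemma3 _ (inj₂ (inj₂ (inj₂ refl)))  = no-L16-decomposition-Q5
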